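{- Let $n \geq 3$ and $s \geq 1$ be integers and let $$f(x) = -1 + x + x^{n} + x^{m_1} + x^{m_2} + \cdots + x^{m_s},$$ where $m_1 - n \geq n-1$ and $m_{j+1} - m_j \geq n-1$ for $1 \leq j < s$. Write $f = A \cdot B \cdot C$, where $A$ is the cyclotomic part, $B$ the reciprocal noncyclotomic part and $C$ the nonreciprocal part of $f$. Then the unique positive real root of $f$ is a root of $C$.
   Context: For $P \in \mathbb{Z}[x]$ of degree $r$, $P^{*}(x) = x^{r}P(1/x)$; $P$ is reciprocal if $P^{*} = P$ and nonreciprocal otherwise. In $f = ABC$: $A$ is the product of the cyclotomic irreducible factors of $f$, $B$ the product of its reciprocal noncyclotomic irreducible factors, and $C$ the product of its nonreciprocal irreducible factors (with multiplicities). -}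

module Defs where

open import Data.Nat as ℕ using (ℕ; zero; suc)
open import Data.Integer as ℤ using (ℤ; +_; -[1+_])
open import Data.Rational as ℚ using (ℚ)
open import Data.List using (List; []; _∷_; reverse; replicate; _++_; foldr)
open import Data.Product using (Σ; ∃; _×_; _,_)
open import Data.Sum using (_⊎_)
open import Data.Unit using (⊤)
open import Relation.Nullary using (¬_; yes; no)
open import Relation.Binary.PropositionalEquality using (_≡_)

-- Polynomials in ℤ[x] as coefficient lists, lowest degree first.

Poly : Set
Poly = List ℤ

norm : Poly → Poly
norm [] = []
norm (a ∷ p) with norm p
... | b ∷ q = a ∷ b ∷ q
... | [] with a ℤ.≟ + 0
...   | yes _ = []
...   | no _ = a ∷ []

_≈_ : Poly → Poly → Set
p ≈ q = norm p ≡ norm q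

infix 4 _≈_
infixl 6 _⊕_
infixl 7 _⊗_

_⊕_ : Poly → Poly → Poly
[] ⊕ q = q
(a ∷ p) ⊕ [] = a ∷ p
(a ∷ p) ⊕ (b ∷ q) = (a ℤ.+ b) ∷ (p ⊕ q)

scale : ℤ → Poly → Poly
scale a [] = []
scale a (b ∷ q) = (a ℤ.* b) ∷ scale a q

_⊗_ : Poly → Poly → Poly
[] ⊗ q = []
(a ∷ p) ⊗ q = scale a q ⊕ (+ 0 ∷ (p ⊗ q))

prod : List Poly → Poly
prod = foldr _⊗_ (+ 1 ∷ [])

monomial : ℕ → Poly
monomial k = replicate k (+ 0) ++ (+ 1 ∷ [])

xpow-1 : ℕ → Poly
xpow-1 k = monomial k ⊕ (-[1+ 0 ] ∷ [])

-- P*(x) = x^deg(P) P(1/x): reverse of the canonical coefficient list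
reciprocalPoly : Poly → Poly
reciprocalPoly p = reverse (norm p)

IsReciprocal : Poly → Set
IsReciprocal p = reciprocalPoly p ≈ p

IsUnit : Poly → Set
IsUnit p = (norm p ≡ + 1 ∷ []) ⊎ (norm p ≡ -[1+ 0 ] ∷ [])

Irreducible : Poly → Set
Irreducible p =
  ¬ (norm p ≡ []) × ¬ IsUnit p × (∀ g h → p ≈ g ⊗ h → IsUnit g ⊎ IsUnit h)

_∣ₚ_ : Poly → Poly → Set
p ∣ₚ q = ∃ λ h → q ≈ p ⊗ h

-- an irreducible polynomial is cyclotomic iff it is (up to sign) some
-- cyclotomic polynomial Φ_d, iff it divides x^k - 1 for some k ≥ 1
IsCyclotomic : Poly → Set
IsCyclotomic p = ∃ λ k → (1 ℕ.≤ k) × (p ∣ₚ xpow-1 k)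

CyclotomicIrreducible : Poly → Set
CyclotomicIrreducible p = Irreducible p × IsCyclotomic p

ReciprocalNoncyclotomicIrreducible : Poly → Set
ReciprocalNoncyclotomicIrreducible p =
  Irreducible p × IsReciprocal p × ¬ IsCyclotomic p

NonreciprocalIrreducible : Poly → Set
NonreciprocalIrreducible p = Irreducible p × ¬ IsReciprocal p

sumMonomials : List ℕ → Poly
sumMonomials [] = []
sumMonomials (m ∷ ms) = monomial m ⊕ sumMonomials ms

fPoly : ℕ → List ℕ → Poly
fPoly n ms = (-[1+ 0 ] ∷ + 1 ∷ []) ⊕ monomial n ⊕ sumMonomials ms

Spaced : ℕ → ℕ → List ℕ → Set
Spaced d prev [] = ⊤
Spaced d prev (m ∷ ms) = (prev ℕ.+ d ℕ.≤ m) × Spaced d m ms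

-- Real numbers as regular Cauchy sequences of rationals

eval : Poly → ℚ → ℚ
eval [] x = ℚ.0ℚ
eval (a ∷ p) x = (a ℚ./ 1) ℚ.+ x ℚ.* eval p x

inv : ℕ → ℚ
inv k = + 1 ℚ./ suc k

record Real : Set where
  field
    seq    : ℕ → ℚ
    cauchy : ∀ k i j → k ℕ.≤ i → k ℕ.≤ j →
             ℚ.∣ seq i ℚ.- seq j ∣ ℚ.≤ inv k
open Real public

Positive : Real → Set
Positive α = ∃ λ k → ∀ i → k ℕ.≤ i → inv k ℚ.≤ seq α i

IsRootOf : Real → Poly → Set
IsRootOf α P =
  ∀ k → ∃ λ N → ∀ i → N ℕ.≤ i → ℚ.∣ eval P (seq α i) ∣ ℚ.≤ inv k

module Submission where

-- Mathematically: f(y) ≥ y - 1 + yⁿ ≥ 1 for y ≥ 1, so α < 1.  A cyclotomic factor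
-- divides some xᵏ - 1, whose only real positive root is 1, so it does not vanish at α.
-- A reciprocal factor P satisfies x·P(x) = x^L·P(1/x); if P(α) = 0 then P(1/α) = 0, so
-- f(1/α) = 0 although 1/α > 1.  Hence (AB)(α) ≠ 0 and C(α) = 0.
--
-- Here α is a Cauchy sequence of rationals xᵢ with f(xᵢ) → 0, so the argument is made
-- quantitative.  Eventually every xᵢ lies in a "window"
-- e ≤ x ≤ 1, (n+1)(1-x) ≥ 3/4, where e > 0 is the positivity bound of α.  On that
-- window every cyclotomic polynomial and every reciprocal divisor of f is bounded away
-- from 0, hence so is A·B, and |C(xᵢ)| ≤ |f(xᵢ)| / inf|A·B| → 0.

open import Defs
open import Data.Nat as ℕ using (ℕ; zero; suc; _∸_; _⊔_)
import Data.Nat.Properties as ℕP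
open import Data.Integer as ℤ using (ℤ; +_; -[1+_])
import Data.Integer.Properties as ℤP
open import Data.Rational as ℚ
  using (ℚ; _+_; _*_; _-_; -_; 0ℚ; 1ℚ; _≤_; _<_; ∣_∣; 1/_; positive; nonNegative)
open import Data.Rational.Properties
import Data.Rational.Unnormalised as ℚᵘ
import Data.Rational.Unnormalised.Properties as ℚᵘP
open import Data.Rational.Solver using (module +-*-Solver)
open +-*-Solver
open import Data.List using (List; []; _∷_; reverse; _++_; length)
import Data.List.Properties as List
open import Data.List.Relation.Unary.All as All using (All; []; _∷_)
open import Data.Product using (Σ; ∃; _×_; _,_; proj₁; proj₂)
open import Data.Sum using (inj₁; inj₂)
open import Data.Unit using (tt)
open import Data.Empty using (⊥-elim)
open import Relation.Nullary using (yes; no)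
open import Relation.Nullary.Decidable using (toWitness)
open import Relation.Binary.PropositionalEquality

emb : ℤ → ℚ
emb a = a ℚ./ 1

emb-toℚᵘ : ∀ a → ℚ.toℚᵘ (emb a) ℚᵘ.≃ ℚᵘ.mkℚᵘ a 0
emb-toℚᵘ a = toℚᵘ-fromℚᵘ (ℚᵘ.mkℚᵘ a 0)

emb-+ : ∀ a b → emb (a ℤ.+ b) ≡ emb a + emb b
emb-+ a b = toℚᵘ-injective (ℚᵘP.≃-trans (emb-toℚᵘ (a ℤ.+ b))
  (ℚᵘP.≃-sym (ℚᵘP.≃-trans (toℚᵘ-homo-+ (emb a) (emb b))
     (ℚᵘP.≃-trans (ℚᵘP.+-cong (emb-toℚᵘ a) (emb-toℚᵘ b)) (ℚᵘ.*≡* cross)))))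
  where
  cross : (a ℤ.* + 1 ℤ.+ b ℤ.* + 1) ℤ.* + 1 ≡ (a ℤ.+ b) ℤ.* + 1
  cross = trans (ℤP.*-identityʳ _)
    (trans (cong₂ ℤ._+_ (ℤP.*-identityʳ a) (ℤP.*-identityʳ b)) (sym (ℤP.*-identityʳ (a ℤ.+ b))))

emb-* : ∀ a b → emb (a ℤ.* b) ≡ emb a * emb b
emb-* a b = toℚᵘ-injective (ℚᵘP.≃-trans (emb-toℚᵘ (a ℤ.* b))
  (ℚᵘP.≃-sym (ℚᵘP.≃-trans (toℚᵘ-homo-* (emb a) (emb b))
     (ℚᵘP.≃-trans (ℚᵘP.*-cong (emb-toℚᵘ a) (emb-toℚᵘ b)) (ℚᵘ.*≡* refl)))))

emb-nonNeg : ∀ k → 0ℚ ≤ emb (+ k)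
emb-nonNeg k = nonNegative⁻¹ _ {{normalize-nonNeg k 1}}

infixr 8 _^_
_^_ : ℚ → ℕ → ℚ
x ^ zero = 1ℚ
x ^ suc k = x * x ^ k

eval-⊕ : ∀ p q x → eval (p ⊕ q) x ≡ eval p x + eval q x
eval-⊕ [] q x = sym (+-identityˡ _)
eval-⊕ (a ∷ p) [] x = sym (+-identityʳ _)
eval-⊕ (a ∷ p) (b ∷ q) x = begin
  emb (a ℤ.+ b) + x * eval (p ⊕ q) x
    ≡⟨ cong₂ (λ u v → u + x * v) (emb-+ a b) (eval-⊕ p q x) ⟩
  (emb a + emb b) + x * (eval p x + eval q x)
    ≡⟨ solve 5 (λ A B X P Q → (A :+ B) :+ X :* (P :+ Q) := (A :+ X :* P) :+ (B :+ X :* Q))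
         refl (emb a) (emb b) x (eval p x) (eval q x) ⟩
  (emb a + x * eval p x) + (emb b + x * eval q x) ∎
  where open ≡-Reasoning

eval-scale : ∀ a q x → eval (scale a q) x ≡ emb a * eval q x
eval-scale a [] x = sym (*-zeroʳ (emb a))
eval-scale a (b ∷ q) x = begin
  emb (a ℤ.* b) + x * eval (scale a q) x
    ≡⟨ cong₂ (λ u v → u + x * v) (emb-* a b) (eval-scale a q x) ⟩
  emb a * emb b + x * (emb a * eval q x)
    ≡⟨ solve 4 (λ A B X Q → A :* B :+ X :* (A :* Q) := A :* (B :+ X :* Q))
         refl (emb a) (emb b) x (eval q x) ⟩
  emb a * (emb b + x * eval q x) ∎
  where open ≡-Reasoning

eval-⊗ : ∀ p q x → eval (p ⊗ q) x ≡ eval p x * eval q x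
eval-⊗ [] q x = sym (*-zeroˡ (eval q x))
eval-⊗ (a ∷ p) q x = begin
  eval (scale a q ⊕ (+ 0 ∷ (p ⊗ q))) x
    ≡⟨ eval-⊕ (scale a q) _ x ⟩
  eval (scale a q) x + (0ℚ + x * eval (p ⊗ q) x)
    ≡⟨ cong₂ _+_ (eval-scale a q x) (trans (+-identityˡ _) (cong (x *_) (eval-⊗ p q x))) ⟩
  emb a * eval q x + x * (eval p x * eval q x)
    ≡⟨ solve 4 (λ A X P Q → A :* Q :+ X :* (P :* Q) := (A :+ X :* P) :* Q)
         refl (emb a) x (eval p x) (eval q x) ⟩
  (emb a + x * eval p x) * eval q x ∎
  where open ≡-Reasoning

eval-norm : ∀ p x → eval (norm p) x ≡ eval p x
eval-norm [] x = refl
eval-norm (a ∷ p) x with norm p | eval-norm p x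
... | b ∷ q | ih = cong (λ t → emb a + x * t) ih
... | [] | ih with a ℤ.≟ + 0
...   | yes refl = sym (trans (cong (λ t → 0ℚ + x * t) (sym ih)) (trans (+-identityˡ _) (*-zeroʳ x)))
...   | no _ = cong (λ t → emb a + x * t) ih

eval-≈ : ∀ {p q} x → p ≈ q → eval p x ≡ eval q x
eval-≈ {p} {q} x p≈q = trans (sym (eval-norm p x)) (trans (cong (λ r → eval r x) p≈q) (eval-norm q x))

eval-monomial : ∀ k x → eval (monomial k) x ≡ x ^ k
eval-monomial zero x = trans (cong (λ t → 1ℚ + t) (*-zeroʳ x)) (+-identityʳ _)
eval-monomial (suc k) x = trans (+-identityˡ _) (cong (x *_) (eval-monomial k x))

eval-xpow-1 : ∀ k x → eval (xpow-1 k) x ≡ x ^ k - 1ℚ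
eval-xpow-1 k x = trans (eval-⊕ (monomial k) (-[1+ 0 ] ∷ []) x)
  (cong₂ _+_ (eval-monomial k x) (trans (cong (λ t → - 1ℚ + t) (*-zeroʳ x)) (+-identityʳ _)))

eval-++ : ∀ q r x → eval (q ++ r) x ≡ eval q x + x ^ length q * eval r x
eval-++ [] r x = sym (trans (+-identityˡ _) (*-identityˡ _))
eval-++ (a ∷ q) r x = begin
  emb a + x * eval (q ++ r) x
    ≡⟨ cong (λ t → emb a + x * t) (eval-++ q r x) ⟩
  emb a + x * (eval q x + x ^ length q * eval r x)
    ≡⟨ solve 5 (λ A X Q W R → A :+ X :* (Q :+ W :* R) := (A :+ X :* Q) :+ (X :* W) :* R)
         refl (emb a) x (eval q x) (x ^ length q) (eval r x) ⟩
  (emb a + x * eval q x) + (x * x ^ length q) * eval r x ∎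
  where open ≡-Reasoning

eval-reverse : ∀ p {x y} → x * y ≡ 1ℚ → x * eval (reverse p) x ≡ x ^ length p * eval p y
eval-reverse [] {x} xy = trans (*-zeroʳ x) (sym (*-zeroʳ 1ℚ))
eval-reverse (a ∷ p) {x} {y} xy = begin
  x * eval (reverse (a ∷ p)) x
    ≡⟨ cong (λ t → x * eval t x) (List.unfold-reverse a p) ⟩
  x * eval (reverse p ++ (a ∷ [])) x
    ≡⟨ cong (x *_) (eval-++ (reverse p) (a ∷ []) x) ⟩
  x * (R + x ^ length (reverse p) * (emb a + x * 0ℚ))
    ≡⟨ cong₂ (λ u v → x * (R + x ^ u * v)) (List.length-reverse p)
         (trans (cong (λ t → emb a + t) (*-zeroʳ x)) (+-identityʳ _)) ⟩
  x * (R + W * emb a)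
    ≡⟨ solve 4 (λ X R W A → X :* (R :+ W :* A) := X :* R :+ X :* W :* A) refl x R W (emb a) ⟩
  x * R + x * W * emb a
    ≡⟨ cong (_+ x * W * emb a) (eval-reverse p xy) ⟩
  W * P + x * W * emb a
    ≡⟨ cong (λ t → W * t + x * W * emb a) (sym (trans (cong (_* P) xy) (*-identityˡ P))) ⟩
  W * ((x * y) * P) + x * W * emb a
    ≡⟨ solve 5 (λ X Y P W A → W :* ((X :* Y) :* P) :+ X :* W :* A := (X :* W) :* (A :+ Y :* P))
         refl x y P W (emb a) ⟩
  (x * W) * (emb a + y * P) ∎
  where
  open ≡-Reasoning
  R = eval (reverse p) x
  W = x ^ length p
  P = eval p y

eval-reciprocal : ∀ {P x y} → IsReciprocal P → x * y ≡ 1ℚ →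
                  x * eval P x ≡ x ^ length (norm P) * eval P y
eval-reciprocal {P} {x} {y} recip xy = begin
  x * eval P x                          ≡⟨ cong (x *_) (sym (eval-≈ {reverse (norm P)} {P} x recip)) ⟩
  x * eval (reverse (norm P)) x         ≡⟨ eval-reverse (norm P) xy ⟩
  x ^ length (norm P) * eval (norm P) y ≡⟨ cong (x ^ length (norm P) *_) (eval-norm P y) ⟩
  x ^ length (norm P) * eval P y        ∎
  where open ≡-Reasoning

0<1 : 0ℚ < 1ℚ
0<1 = positive⁻¹ 1ℚ

0≤1 : 0ℚ ≤ 1ℚ
0≤1 = <⇒≤ 0<1

inv-pos : ∀ k → 0ℚ < inv k
inv-pos k = positive⁻¹ (inv k) {{normalize-pos 1 (suc k)}}

inv3<1 : inv 3 < 1ℚ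
inv3<1 = toWitness {a? = inv 3 ℚ.<? 1ℚ} tt

≤-by-gap : ∀ {a b} c → 0ℚ ≤ c → a + c ≡ b → a ≤ b
≤-by-gap {a} c 0≤c a+c≡b =
  ≤-trans (≤-reflexive (sym (+-identityʳ a))) (≤-trans (+-monoʳ-≤ a 0≤c) (≤-reflexive a+c≡b))

≤-+1 : ∀ a → a ≤ a + 1ℚ
≤-+1 a = ≤-by-gap 1ℚ 0≤1 refl

sub-nonNeg : ∀ {a b} → a ≤ b → 0ℚ ≤ b - a
sub-nonNeg {a} a≤b = ≤-trans (≤-reflexive (sym (+-inverseʳ a))) (+-monoˡ-≤ (- a) a≤b)

sub-antimono : ∀ w {u v} → u ≤ v → w - v ≤ w - u
sub-antimono w u≤v = +-monoʳ-≤ w (neg-antimono-≤ u≤v)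

*-nonNeg : ∀ {a b} → 0ℚ ≤ a → 0ℚ ≤ b → 0ℚ ≤ a * b
*-nonNeg {a} {b} 0≤a 0≤b = nonNegative⁻¹ _ {{nonNeg*nonNeg⇒nonNeg a {{nonNegative 0≤a}} b {{nonNegative 0≤b}}}}

*-pos : ∀ {a b} → 0ℚ < a → 0ℚ < b → 0ℚ < a * b
*-pos {a} {b} 0<a 0<b = positive⁻¹ _ {{pos*pos⇒pos a {{positive 0<a}} b {{positive 0<b}}}}

scaleʳ-≤ : ∀ {p q} r → 0ℚ ≤ r → p ≤ q → p * r ≤ q * r
scaleʳ-≤ r 0≤r = *-monoʳ-≤-nonNeg r {{nonNegative 0≤r}}

scaleˡ-≤ : ∀ {p q} r → 0ℚ ≤ r → p ≤ q → r * p ≤ r * q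
scaleˡ-≤ r 0≤r = *-monoˡ-≤-nonNeg r {{nonNegative 0≤r}}

*-mono-≤ : ∀ {a b c d} → 0ℚ ≤ a → 0ℚ ≤ c → a ≤ b → c ≤ d → a * c ≤ b * d
*-mono-≤ {b = b} 0≤a 0≤c a≤b c≤d =
  ≤-trans (scaleʳ-≤ _ 0≤c a≤b) (scaleˡ-≤ b (≤-trans 0≤a a≤b) c≤d)

≤-*-+1 : ∀ {b a H} → 0ℚ ≤ a → b ≤ a * H → b ≤ a * (H + 1ℚ)
≤-*-+1 {a = a} {H} 0≤a b≤aH = ≤-trans b≤aH (scaleˡ-≤ a 0≤a (≤-+1 H))

p≤∣p∣ : ∀ p → p ≤ ∣ p ∣
p≤∣p∣ p with ≤-total 0ℚ p
... | inj₁ 0≤p = ≤-reflexive (sym (0≤p⇒∣p∣≡p 0≤p))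
... | inj₂ p≤0 = ≤-trans p≤0 (0≤∣p∣ p)

∣p∣≡-p : ∀ p → p ≤ 0ℚ → ∣ p ∣ ≡ - p
∣p∣≡-p p p≤0 = trans (sym (∣-p∣≡∣p∣ p))
  (0≤p⇒∣p∣≡p (≤-trans (≤-reflexive (sym (+-inverseʳ 0ℚ))) (neg-antimono-≤ p≤0)))

inverse-antitone : ∀ {x y u v} → 0ℚ ≤ y → 0ℚ ≤ v → x * y ≡ 1ℚ → u * v ≡ 1ℚ → u ≤ x → y ≤ v
inverse-antitone {x} {y} {u} {v} 0≤y 0≤v xy uv u≤x = begin
  y             ≡⟨ sym (trans (cong (y *_) uv) (*-identityʳ y)) ⟩
  y * (u * v)   ≡⟨ solve 3 (λ Y U V → Y :* (U :* V) := (U :* Y) :* V) refl y u v ⟩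
  (u * y) * v   ≤⟨ scaleʳ-≤ v 0≤v (scaleʳ-≤ y 0≤y u≤x) ⟩
  (x * y) * v   ≡⟨ trans (cong (_* v) xy) (*-identityˡ v) ⟩
  v             ∎
  where open ≤-Reasoning

archimedean : ∀ q → 0ℚ < q → ∃ λ j → inv j ≤ q
archimedean (ℚ.mkℚ (+ zero) j _) (ℚ.*<* (ℤ.+<+ ()))
archimedean (ℚ.mkℚ (+ suc p) j _) _ = j , toℚᵘ-cancel-≤
  (ℚᵘP.≤-respˡ-≃ (ℚᵘP.≃-sym (toℚᵘ-fromℚᵘ (ℚᵘ.mkℚᵘ (+ 1) j)))
     (ℚᵘ.*≤* (ℤP.*-monoʳ-≤-nonNeg (+ suc j) {+ 1} {+ suc p} (ℤ.+≤+ (ℕ.s≤s ℕ.z≤n)))))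
archimedean (ℚ.mkℚ -[1+ p ] j _) (ℚ.*<* ())

^-nonNeg : ∀ {x} k → 0ℚ ≤ x → 0ℚ ≤ x ^ k
^-nonNeg zero _ = 0≤1
^-nonNeg (suc k) 0≤x = *-nonNeg 0≤x (^-nonNeg k 0≤x)

^-pos : ∀ {x} k → 0ℚ < x → 0ℚ < x ^ k
^-pos zero _ = 0<1
^-pos (suc k) 0<x = *-pos 0<x (^-pos k 0<x)

^-≤1 : ∀ {x} k → 0ℚ ≤ x → x ≤ 1ℚ → x ^ k ≤ 1ℚ
^-≤1 zero _ _ = ≤-refl
^-≤1 (suc k) 0≤x x≤1 = ≤-trans (*-mono-≤ 0≤x (^-nonNeg k 0≤x) x≤1 (^-≤1 k 0≤x x≤1)) (≤-reflexive (*-identityˡ 1ℚ))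

1≤^ : ∀ {x} k → 1ℚ ≤ x → 1ℚ ≤ x ^ k
1≤^ zero _ = ≤-refl
1≤^ (suc k) 1≤x = ≤-trans (≤-reflexive (sym (*-identityˡ 1ℚ))) (*-mono-≤ 0≤1 0≤1 1≤x (1≤^ k 1≤x))

^-monoˡ-≤ : ∀ {a b} k → 0ℚ ≤ a → a ≤ b → a ^ k ≤ b ^ k
^-monoˡ-≤ zero _ _ = ≤-refl
^-monoˡ-≤ (suc k) 0≤a a≤b = *-mono-≤ 0≤a (^-nonNeg k 0≤a) a≤b (^-monoˡ-≤ k 0≤a a≤b)

^-suc-≤ : ∀ {x} k → 0ℚ ≤ x → x ≤ 1ℚ → x ^ suc k ≤ x
^-suc-≤ {x} k 0≤x x≤1 = ≤-trans (scaleˡ-≤ x 0≤x (^-≤1 k 0≤x x≤1)) (≤-reflexive (*-identityʳ x))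

bernoulli : ∀ {x} n → 0ℚ ≤ x → x ≤ 1ℚ → 1ℚ - emb (+ n) * (1ℚ - x) ≤ x ^ n
bernoulli {x} zero _ _ = ≤-reflexive (trans (cong (λ t → 1ℚ - t) (*-zeroˡ (1ℚ - x))) (+-identityʳ 1ℚ))
bernoulli {x} (suc n) 0≤x x≤1 = ≤-trans step (scaleˡ-≤ x 0≤x (bernoulli n 0≤x x≤1))
  where
  N = emb (+ n)
  -- the two sides differ by n(1 - x)² ≥ 0
  step : 1ℚ - emb (+ suc n) * (1ℚ - x) ≤ x * (1ℚ - N * (1ℚ - x))
  step = ≤-by-gap (N * (1ℚ - x) * (1ℚ - x))
    (*-nonNeg (*-nonNeg (emb-nonNeg n) (sub-nonNeg x≤1)) (sub-nonNeg x≤1))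
    (trans (cong (λ t → 1ℚ - t * (1ℚ - x) + N * (1ℚ - x) * (1ℚ - x)) (emb-+ (+ 1) (+ n)))
      (solve 2 (λ N X → (con 1ℚ :- (con 1ℚ :+ N) :* (con 1ℚ :- X)) :+ N :* (con 1ℚ :- X) :* (con 1ℚ :- X)
                    := X :* (con 1ℚ :- N :* (con 1ℚ :- X))) refl N x))

coeffBound : Poly → ℚ → ℚ
coeffBound [] K = 0ℚ
coeffBound (a ∷ p) K = ∣ emb a ∣ + K * coeffBound p K

eval-≤-coeffBound : ∀ p {x K} → ∣ x ∣ ≤ K → ∣ eval p x ∣ ≤ coeffBound p K
eval-≤-coeffBound [] _ = ≤-refl
eval-≤-coeffBound (a ∷ p) {x} ∣x∣≤K = ≤-trans (∣p+q∣≤∣p∣+∣q∣ (emb a) (x * eval p x))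
  (+-monoʳ-≤ ∣ emb a ∣ (≤-trans (≤-reflexive (∣p*q∣≡∣p∣*∣q∣ x (eval p x)))
     (*-mono-≤ (0≤∣p∣ x) (0≤∣p∣ _) ∣x∣≤K (eval-≤-coeffBound p ∣x∣≤K))))

coeffBound-nonNeg : ∀ p {K} → 0ℚ ≤ K → 0ℚ ≤ coeffBound p K
coeffBound-nonNeg p 0≤K = ≤-trans (0≤∣p∣ (eval p 0ℚ)) (eval-≤-coeffBound p 0≤K)

reciprocal-value-bound : ∀ {P x y} → IsReciprocal P → 0ℚ ≤ x → x ≤ 1ℚ → x * y ≡ 1ℚ →
                         x ^ length (norm P) * ∣ eval P y ∣ ≤ ∣ eval P x ∣
reciprocal-value-bound {P} {x} {y} recip 0≤x x≤1 xy = begin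
  W * ∣ eval P y ∣      ≡⟨ cong (_* ∣ eval P y ∣) (sym (0≤p⇒∣p∣≡p (^-nonNeg L 0≤x))) ⟩
  ∣ W ∣ * ∣ eval P y ∣  ≡⟨ sym (∣p*q∣≡∣p∣*∣q∣ W (eval P y)) ⟩
  ∣ W * eval P y ∣      ≡⟨ cong ∣_∣ (sym (eval-reciprocal {P} {x} {y} recip xy)) ⟩
  ∣ x * eval P x ∣      ≡⟨ trans (∣p*q∣≡∣p∣*∣q∣ x (eval P x)) (cong (_* ∣ eval P x ∣) (0≤p⇒∣p∣≡p 0≤x)) ⟩
  x * ∣ eval P x ∣      ≤⟨ scaleʳ-≤ (∣ eval P x ∣) (0≤∣p∣ _) x≤1 ⟩
  1ℚ * ∣ eval P x ∣     ≡⟨ *-identityˡ _ ⟩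
  ∣ eval P x ∣          ∎
  where
  open ≤-Reasoning
  L = length (norm P)
  W = x ^ L

cyclotomic-value-bound : ∀ {P h} k → xpow-1 (suc k) ≈ P ⊗ h → ∀ {x} → 0ℚ ≤ x → x ≤ 1ℚ →
                         1ℚ - x ≤ ∣ eval P x ∣ * coeffBound h 1ℚ
cyclotomic-value-bound {P} {h} k xᵏ⁺¹-1≈Ph {x} 0≤x x≤1 = begin
  1ℚ - x                          ≤⟨ sub-antimono 1ℚ (^-suc-≤ k 0≤x x≤1) ⟩
  1ℚ - xᵏ⁺¹                       ≡⟨ sym value ⟩
  ∣ eval P x ∣ * ∣ eval h x ∣     ≤⟨ scaleˡ-≤ (∣ eval P x ∣) (0≤∣p∣ _)
                                      (eval-≤-coeffBound h (≤-trans (≤-reflexive (0≤p⇒∣p∣≡p 0≤x)) x≤1)) ⟩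
  ∣ eval P x ∣ * coeffBound h 1ℚ  ∎
  where
  open ≤-Reasoning
  xᵏ⁺¹ = x ^ suc k
  value : ∣ eval P x ∣ * ∣ eval h x ∣ ≡ 1ℚ - xᵏ⁺¹
  value = begin-equality
    ∣ eval P x ∣ * ∣ eval h x ∣  ≡⟨ sym (∣p*q∣≡∣p∣*∣q∣ (eval P x) (eval h x)) ⟩
    ∣ eval P x * eval h x ∣      ≡⟨ cong ∣_∣ (sym (trans (eval-≈ {xpow-1 (suc k)} {P ⊗ h} x xᵏ⁺¹-1≈Ph) (eval-⊗ P h x))) ⟩
    ∣ eval (xpow-1 (suc k)) x ∣  ≡⟨ cong ∣_∣ (eval-xpow-1 (suc k) x) ⟩
    ∣ xᵏ⁺¹ - 1ℚ ∣                ≡⟨ ∣p∣≡-p (xᵏ⁺¹ - 1ℚ) (≤-trans (+-monoˡ-≤ (- 1ℚ) (^-≤1 (suc k) 0≤x x≤1))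
                                                              (≤-reflexive (+-inverseʳ 1ℚ))) ⟩
    - (xᵏ⁺¹ - 1ℚ)                ≡⟨ solve 1 (λ W → :- (W :- con 1ℚ) := con 1ℚ :- W) refl xᵏ⁺¹ ⟩
    1ℚ - xᵏ⁺¹                    ∎

eval-sumMonomials-nonNeg : ∀ ms {x} → 0ℚ ≤ x → 0ℚ ≤ eval (sumMonomials ms) x
eval-sumMonomials-nonNeg [] _ = ≤-refl
eval-sumMonomials-nonNeg (m ∷ ms) {x} 0≤x =
  ≤-trans (+-mono-≤ (≤-trans (^-nonNeg m 0≤x) (≤-reflexive (sym (eval-monomial m x))))
                    (eval-sumMonomials-nonNeg ms 0≤x))
    (≤-reflexive (sym (eval-⊕ (monomial m) (sumMonomials ms) x)))

eval-fPoly : ∀ n ms x → eval (fPoly n ms) x ≡ (x - 1ℚ) + x ^ n + eval (sumMonomials ms) x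
eval-fPoly n ms x = begin
  eval (fPoly n ms) x
    ≡⟨ eval-⊕ ((-[1+ 0 ] ∷ + 1 ∷ []) ⊕ monomial n) (sumMonomials ms) x ⟩
  eval ((-[1+ 0 ] ∷ + 1 ∷ []) ⊕ monomial n) x + S
    ≡⟨ cong (_+ S) (eval-⊕ (-[1+ 0 ] ∷ + 1 ∷ []) (monomial n) x) ⟩
  (- 1ℚ + x * (1ℚ + x * 0ℚ)) + eval (monomial n) x + S
    ≡⟨ cong₂ (λ u v → (- 1ℚ + x * (1ℚ + u)) + v + S) (*-zeroʳ x) (eval-monomial n x) ⟩
  (- 1ℚ + x * (1ℚ + 0ℚ)) + x ^ n + S
    ≡⟨ cong (λ t → t + x ^ n + S) (solve 1 (λ X → :- con 1ℚ :+ X :* (con 1ℚ :+ con 0ℚ) := X :- con 1ℚ) refl x) ⟩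
  (x - 1ℚ) + x ^ n + S ∎
  where
  open ≡-Reasoning
  S = eval (sumMonomials ms) x

fPoly-lower : ∀ n ms {x} → 0ℚ ≤ x → (x - 1ℚ) + x ^ n ≤ eval (fPoly n ms) x
fPoly-lower n ms {x} 0≤x = ≤-by-gap _ (eval-sumMonomials-nonNeg ms 0≤x) (sym (eval-fPoly n ms x))

fPoly-≥1 : ∀ n ms {y} → 1ℚ ≤ y → 1ℚ ≤ eval (fPoly n ms) y
fPoly-≥1 n ms 1≤y = ≤-trans (≤-reflexive (sym (+-identityˡ 1ℚ)))
  (≤-trans (+-mono-≤ (sub-nonNeg 1≤y) (1≤^ n 1≤y)) (fPoly-lower n ms (≤-trans 0≤1 1≤y)))

fPoly-below-1 : ∀ n ms {x} → 0ℚ ≤ x → x ≤ 1ℚ →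
                1ℚ - (1ℚ + emb (+ n)) * (1ℚ - x) ≤ eval (fPoly n ms) x
fPoly-below-1 n ms {x} 0≤x x≤1 =
  ≤-trans (≤-reflexive (solve 2 (λ N X → con 1ℚ :- (con 1ℚ :+ N) :* (con 1ℚ :- X)
                                   := (X :- con 1ℚ) :+ (con 1ℚ :- N :* (con 1ℚ :- X))) refl (emb (+ n)) x))
    (≤-trans (+-monoʳ-≤ (x - 1ℚ) (bernoulli n 0≤x x≤1)) (fPoly-lower n ms 0≤x))

infix 4 _∣ᵥ_
_∣ᵥ_ : Poly → Poly → Set
P ∣ᵥ F = Σ Poly λ G → ∀ y → eval F y ≡ eval P y * eval G y

≈⇒∣ᵥ : ∀ {F P G} → F ≈ P ⊗ G → P ∣ᵥ F
≈⇒∣ᵥ {F} {P} {G} F≈PG = G , λ y → trans (eval-≈ {F} {P ⊗ G} y F≈PG) (eval-⊗ P G y)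

∣ᵥ-⊗ˡ : ∀ {P Q F} → P ⊗ Q ∣ᵥ F → P ∣ᵥ F
∣ᵥ-⊗ˡ {P} {Q} (G , F≡PQG) = Q ⊗ G , λ y →
  trans (F≡PQG y) (trans (cong (_* eval G y) (eval-⊗ P Q y))
    (trans (*-assoc (eval P y) (eval Q y) (eval G y)) (cong (eval P y *_) (sym (eval-⊗ Q G y)))))

∣ᵥ-⊗ʳ : ∀ {P Q F} → P ⊗ Q ∣ᵥ F → Q ∣ᵥ F
∣ᵥ-⊗ʳ {P} {Q} (G , F≡PQG) = P ⊗ G , λ y →
  trans (F≡PQG y) (trans (cong (_* eval G y) (eval-⊗ P Q y))
    (trans (solve 3 (λ P Q G → (P :* Q) :* G := Q :* (P :* G)) refl (eval P y) (eval Q y) (eval G y))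
      (cong (eval Q y *_) (sym (eval-⊗ P G y)))))

factors-∣ᵥ : ∀ ps {F} → prod ps ∣ᵥ F → All (_∣ᵥ F) ps
factors-∣ᵥ [] _ = []
factors-∣ᵥ (p ∷ ps) {F} d = ∣ᵥ-⊗ˡ {p} {prod ps} {F} d ∷ factors-∣ᵥ ps {F} (∣ᵥ-⊗ʳ {p} {prod ps} {F} d)

-- Fix f = fPoly n ms and the positivity bound e = 1/(k₀+1) of the root.  Near-roots of f
-- beyond e lie in a window strictly below 1, on which the factors A and B are bounded below.
module Window (n : ℕ) (ms : List ℕ) (k₀ : ℕ) where

  f : Poly
  f = fPoly n ms

  e : ℚ
  e = inv k₀

  instance
    e-nonZero : ℚ.NonZero e
    e-nonZero = pos⇒nonZero e {{normalize-pos 1 (suc k₀)}}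

  0≤e : 0ℚ ≤ e
  0≤e = <⇒≤ (inv-pos k₀)

  M : ℚ
  M = 1ℚ + emb (+ n)

  0<M : 0ℚ < M
  0<M = <-≤-trans 0<1 (≤-by-gap _ (emb-nonNeg n) refl)

  0≤M : 0ℚ ≤ M
  0≤M = <⇒≤ 0<M

  record InWindow (x : ℚ) : Set where
    field
      lower : e ≤ x
      upper : x ≤ 1ℚ
      gap   : 1ℚ - inv 3 ≤ M * (1ℚ - x)
  open InWindow

  -- A point beyond e where |f| ≤ 1/4 is in the window: it is ≤ 1 since f ≥ 1 beyond 1,
  -- and it keeps distance 3/(4M) from 1 since f(x) ≥ 1 - M(1 - x).
  near-root-in-window : ∀ {x} → e ≤ x → ∣ eval f x ∣ ≤ inv 3 → InWindow x
  near-root-in-window {x} e≤x ∣fx∣≤¼ = record { lower = e≤x ; upper = x≤1 ; gap = gap′ }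
    where
    0≤x = ≤-trans 0≤e e≤x
    fx≤¼ : eval f x ≤ inv 3
    fx≤¼ = ≤-trans (p≤∣p∣ _) ∣fx∣≤¼
    x≤1 : x ≤ 1ℚ
    x≤1 with ≤-total x 1ℚ
    ... | inj₁ x≤1 = x≤1
    ... | inj₂ 1≤x = ⊥-elim (<-irrefl refl (<-≤-trans inv3<1 (≤-trans (fPoly-≥1 n ms 1≤x) fx≤¼)))
    gap′ : 1ℚ - inv 3 ≤ M * (1ℚ - x)
    gap′ = ≤-trans (sub-antimono 1ℚ (≤-trans (fPoly-below-1 n ms 0≤x x≤1) fx≤¼))
             (≤-reflexive (solve 1 (λ Z → con 1ℚ :- (con 1ℚ :- Z) := Z) refl (M * (1ℚ - x))))

  BoundedBelow : Poly → Set
  BoundedBelow P = Σ ℚ λ r → Σ ℚ λ Q → 0ℚ < r × 0ℚ < Q × (∀ x → InWindow x → r ≤ ∣ eval P x ∣ * Q)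

  boundedBelow-one : BoundedBelow (+ 1 ∷ [])
  boundedBelow-one = 1ℚ , 1ℚ , 0<1 , 0<1 , λ x _ →
    ≤-reflexive (trans (sym (*-identityˡ 1ℚ)) (cong (λ t → ∣ t ∣ * 1ℚ) (sym (eval-monomial 0 x))))

  boundedBelow-⊗ : ∀ {P R} → BoundedBelow P → BoundedBelow R → BoundedBelow (P ⊗ R)
  boundedBelow-⊗ {P} {R} (r₁ , Q₁ , 0<r₁ , 0<Q₁ , bP) (r₂ , Q₂ , 0<r₂ , 0<Q₂ , bR) =
    r₁ * r₂ , Q₁ * Q₂ , *-pos 0<r₁ 0<r₂ , *-pos 0<Q₁ 0<Q₂ , λ x win →
      ≤-trans (*-mono-≤ (<⇒≤ 0<r₁) (<⇒≤ 0<r₂) (bP x win) (bR x win))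
        (≤-reflexive (trans
          (solve 4 (λ a b c d → (a :* c) :* (b :* d) := (a :* b) :* (c :* d)) refl
             ∣ eval P x ∣ ∣ eval R x ∣ Q₁ Q₂)
          (cong (_* (Q₁ * Q₂)) (trans (sym (∣p*q∣≡∣p∣*∣q∣ (eval P x) (eval R x)))
                                       (cong ∣_∣ (sym (eval-⊗ P R x)))))))

  boundedBelow-prod : ∀ ps → All BoundedBelow ps → BoundedBelow (prod ps)
  boundedBelow-prod [] [] = boundedBelow-one
  boundedBelow-prod (p ∷ ps) (bp ∷ bps) = boundedBelow-⊗ {p} {prod ps} bp (boundedBelow-prod ps bps)

  -- Cyclotomic polynomials: |P(x)| ≥ (1 - x)/H ≥ (3/4)/(M·H) on the window.
  cyclotomic-boundedBelow : ∀ {P} → IsCyclotomic P → BoundedBelow P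
  cyclotomic-boundedBelow {P} (suc k , _ , h , xᵏ⁺¹-1≈Ph) =
    1ℚ - inv 3 , M * (H + 1ℚ) , positive⁻¹ (1ℚ - inv 3) ,
    *-pos 0<M (<-≤-trans 0<1 (≤-by-gap _ 0≤H (+-comm 1ℚ H))) , bound
    where
    open ≤-Reasoning
    H = coeffBound h 1ℚ
    0≤H = coeffBound-nonNeg h 0≤1
    bound : ∀ x → InWindow x → 1ℚ - inv 3 ≤ ∣ eval P x ∣ * (M * (H + 1ℚ))
    bound x win = begin
      1ℚ - inv 3                      ≤⟨ gap win ⟩
      M * (1ℚ - x)                    ≤⟨ scaleˡ-≤ M 0≤M
                                           (≤-*-+1 (0≤∣p∣ (eval P x))
                                             (cyclotomic-value-bound {P} {h} k xᵏ⁺¹-1≈Ph (≤-trans 0≤e (lower win)) (upper win))) ⟩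
      M * (∣ eval P x ∣ * (H + 1ℚ))   ≡⟨ solve 3 (λ A B C → A :* (B :* C) := B :* (A :* C)) refl M (∣ eval P x ∣) (H + 1ℚ) ⟩
      ∣ eval P x ∣ * (M * (H + 1ℚ))   ∎

  -- A reciprocal divisor P of f: with y = 1/x ∈ [1, 1/e] we have 1 ≤ f(y) ≤ |P(y)|·G, and
  -- reciprocity transports this to |P(x)| ≥ x^L |P(y)| ≥ e^L / G.
  reciprocal-divisor-boundedBelow : ∀ {P} → IsReciprocal P → P ∣ᵥ f → BoundedBelow P
  reciprocal-divisor-boundedBelow {P} recip (g , f≡Pg) =
    e ^ L , G + 1ℚ , ^-pos L (inv-pos k₀) , <-≤-trans 0<1 (≤-by-gap _ 0≤G (+-comm 1ℚ G)) , bound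
    where
    L = length (norm P)
    G = coeffBound g (1/ e)
    0≤1/e = nonNegative⁻¹ (1/ e) {{pos⇒nonNeg (1/ e) {{1/pos⇒pos e {{normalize-pos 1 (suc k₀)}}}}}}
    0≤G = coeffBound-nonNeg g 0≤1/e

    beyond-1 : ∀ {y} → 1ℚ ≤ y → y ≤ 1/ e → 1ℚ ≤ ∣ eval P y ∣ * G
    beyond-1 {y} 1≤y y≤1/e = begin
      1ℚ                          ≤⟨ f≥1 ⟩
      eval f y                    ≡⟨ sym (0≤p⇒∣p∣≡p (≤-trans 0≤1 f≥1)) ⟩
      ∣ eval f y ∣                ≡⟨ trans (cong ∣_∣ (f≡Pg y)) (∣p*q∣≡∣p∣*∣q∣ (eval P y) (eval g y)) ⟩
      ∣ eval P y ∣ * ∣ eval g y ∣ ≤⟨ scaleˡ-≤ (∣ eval P y ∣) (0≤∣p∣ _)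
                                       (eval-≤-coeffBound g (≤-trans (≤-reflexive (0≤p⇒∣p∣≡p (≤-trans 0≤1 1≤y))) y≤1/e)) ⟩
      ∣ eval P y ∣ * G            ∎
      where
      open ≤-Reasoning
      f≥1 = fPoly-≥1 n ms 1≤y

    bound : ∀ x → InWindow x → e ^ L ≤ ∣ eval P x ∣ * (G + 1ℚ)
    bound x win = begin
      e ^ L                              ≡⟨ sym (*-identityʳ (e ^ L)) ⟩
      e ^ L * 1ℚ                         ≤⟨ *-mono-≤ (^-nonNeg L 0≤e) 0≤1 (^-monoˡ-≤ L 0≤e (lower win))
                                              (≤-*-+1 (0≤∣p∣ (eval P y)) (beyond-1 1≤y y≤1/e)) ⟩
      x ^ L * (∣ eval P y ∣ * (G + 1ℚ))  ≡⟨ sym (*-assoc (x ^ L) (∣ eval P y ∣) (G + 1ℚ)) ⟩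
      (x ^ L * ∣ eval P y ∣) * (G + 1ℚ)  ≤⟨ scaleʳ-≤ (G + 1ℚ) (≤-trans 0≤G (≤-+1 G))
                                              (reciprocal-value-bound {P} recip 0≤x (upper win) xy) ⟩
      ∣ eval P x ∣ * (G + 1ℚ)            ∎
      where
      open ≤-Reasoning
      0<x = <-≤-trans (inv-pos k₀) (lower win)
      0≤x = <⇒≤ 0<x
      instance
        x-nonZero : ℚ.NonZero x
        x-nonZero = pos⇒nonZero x {{positive 0<x}}
      y = 1/ x
      xy : x * y ≡ 1ℚ
      xy = *-inverseʳ x
      0≤y = nonNegative⁻¹ y {{pos⇒nonNeg y {{1/pos⇒pos x {{positive 0<x}}}}}}
      1≤y : 1ℚ ≤ y
      1≤y = inverse-antitone 0≤1 0≤y (*-identityˡ 1ℚ) xy (upper win)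
      y≤1/e : y ≤ 1/ e
      y≤1/e = inverse-antitone 0≤y 0≤1/e xy (*-inverseʳ e) (lower win)

  cofactor-small : ∀ {D C} → BoundedBelow D → f ≈ D ⊗ C →
    ∀ k → ∃ λ j → ∀ x → InWindow x → ∣ eval f x ∣ ≤ inv j → ∣ eval C x ∣ ≤ inv k
  cofactor-small {D} {C} (r , Q , 0<r , 0<Q , bD) f≈DC k = j , small
    where
    instance
      Q-nonZero : ℚ.NonZero Q
      Q-nonZero = pos⇒nonZero Q {{positive 0<Q}}
    δ = r * inv k * 1/ Q
    0<δ : 0ℚ < δ
    0<δ = *-pos (*-pos 0<r (inv-pos k)) (positive⁻¹ (1/ Q) {{1/pos⇒pos Q {{positive 0<Q}}}})
    j = proj₁ (archimedean δ 0<δ)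
    small : ∀ x → InWindow x → ∣ eval f x ∣ ≤ inv j → ∣ eval C x ∣ ≤ inv k
    small x win ∣fx∣≤ = *-cancelˡ-≤-pos r {{positive 0<r}} (begin
      r * ∣ eval C x ∣                    ≤⟨ scaleʳ-≤ (∣ eval C x ∣) (0≤∣p∣ _) (bD x win) ⟩
      (∣ eval D x ∣ * Q) * ∣ eval C x ∣   ≡⟨ solve 3 (λ a q c → (a :* q) :* c := (a :* c) :* q) refl
                                                (∣ eval D x ∣) Q (∣ eval C x ∣) ⟩
      (∣ eval D x ∣ * ∣ eval C x ∣) * Q   ≡⟨ cong (_* Q) (sym ∣f∣≡∣D∣∣C∣) ⟩
      ∣ eval f x ∣ * Q                    ≤⟨ scaleʳ-≤ Q (<⇒≤ 0<Q) (≤-trans ∣fx∣≤ (proj₂ (archimedean δ 0<δ))) ⟩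
      δ * Q                               ≡⟨ trans (*-assoc (r * inv k) (1/ Q) Q)
                                               (trans (cong (r * inv k *_) (*-inverseˡ Q)) (*-identityʳ _)) ⟩
      r * inv k                           ∎)
      where
      open ≤-Reasoning
      ∣f∣≡∣D∣∣C∣ : ∣ eval f x ∣ ≡ ∣ eval D x ∣ * ∣ eval C x ∣
      ∣f∣≡∣D∣∣C∣ = trans (cong ∣_∣ (trans (eval-≈ {f} {D ⊗ C} x f≈DC) (eval-⊗ D C x)))
                          (∣p*q∣≡∣p∣*∣q∣ (eval D x) (eval C x))

  eventually-in-window : (α : Real) → (∀ i → k₀ ℕ.≤ i → e ≤ seq α i) → IsRootOf α f →
    ∃ λ N → ∀ i → N ℕ.≤ i → InWindow (seq α i)
  eventually-in-window α α≥e root = k₀ ⊔ N , λ i k₀⊔N≤i →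
    near-root-in-window (α≥e i (ℕP.m⊔n≤o⇒m≤o k₀ N k₀⊔N≤i)) (proj₂ (root 3) i (ℕP.m⊔n≤o⇒n≤o k₀ N k₀⊔N≤i))
    where N = proj₁ (root 3)

  cofactor-vanishes : ∀ {D C} → BoundedBelow D → f ≈ D ⊗ C →
    (α : Real) → (∀ i → k₀ ℕ.≤ i → e ≤ seq α i) → IsRootOf α f → IsRootOf α C
  cofactor-vanishes {D} {C} bD f≈DC α α≥e root k = N₁ ⊔ N₂ , λ i N≤i →
    small (seq α i) (inWindow i (ℕP.m⊔n≤o⇒m≤o N₁ N₂ N≤i)) (fSmall i (ℕP.m⊔n≤o⇒n≤o N₁ N₂ N≤i))
    where
    j = proj₁ (cofactor-small {D} {C} bD f≈DC k)
    small = proj₂ (cofactor-small {D} {C} bD f≈DC k)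
    N₁ = proj₁ (eventually-in-window α α≥e root)
    inWindow = proj₂ (eventually-in-window α α≥e root)
    N₂ = proj₁ (root j)
    fSmall = proj₂ (root j)

mainTheorem3 : (n s : ℕ) → 3 ℕ.≤ n → 1 ℕ.≤ s →
    (ms : List ℕ) → length ms ≡ s → Spaced (n ∸ 1) n ms →
    (as bs cs : List Poly) →
    All CyclotomicIrreducible as →
    All ReciprocalNoncyclotomicIrreducible bs →
    All NonreciprocalIrreducible cs →
    fPoly n ms ≈ prod as ⊗ prod bs ⊗ prod cs →
    (α : Real) → Positive α → IsRootOf α (fPoly n ms) →
    IsRootOf α (prod cs)
mainTheorem3 n _ _ _ ms _ _ as bs cs cyclotomic reciprocal _ f≈ABC α (k₀ , α≥e) root =
  cofactor-vanishes {A ⊗ B} {prod cs} (boundedBelow-⊗ {A} {B} boundedA boundedB) f≈ABC α α≥e root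
  where
  open Window n ms k₀
  A = prod as
  B = prod bs
  boundedA : BoundedBelow A
  boundedA = boundedBelow-prod as (All.map (λ {p} c → cyclotomic-boundedBelow {p} (proj₂ c)) cyclotomic)
  B∣f : All (_∣ᵥ f) bs
  B∣f = factors-∣ᵥ bs {f} (∣ᵥ-⊗ʳ {A} {B} {f} (≈⇒∣ᵥ {f} {A ⊗ B} {prod cs} f≈ABC))
  boundedB : BoundedBelow B
  boundedB = boundedBelow-prod bs (All.zipWith
    (λ {b} (irreducible , b∣f) → reciprocal-divisor-boundedBelow {b} (proj₁ (proj₂ irreducible)) b∣f)
    (reciprocal , B∣f))
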